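{- Let $k$ be a non-negative integer. For $|q|<1$, $$(q^2;q^2)^2_\infty \sum_{j=0}^\infty \frac{q^{2j+k}}{(q^2;q^2)_j\,(q^2;q^2)_{j+k}} = \sum_{j=k}^\infty (-1)^{j-k}\,q^{j(j+1)-k^2}.$$
   Context: For $n\ge0$, $(a;p)_n=\prod_{r=0}^{n-1}(1-ap^r)$ with $(a;p)_0=1$, and $(a;p)_\infty=\lim_{n\to\infty}(a;p)_n$ for $|p|<1$; here the base is $p=q^2$. -}

module Defs where

open import Data.Nat using (ℕ; zero; suc; _∸_; _≡ᵇ_) renaming (_+_ to _+ℕ_; _*_ to _*ℕ_)
open import Data.Integer using (ℤ; _+_; _*_; -_; 0ℤ; 1ℤ)
open import Data.List using (List; map; upTo; foldr)
open import Data.Bool using (if_then_else_)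

-- Formal power series in q with integer coefficients: n ↦ coefficient of q^n.
PS : Set
PS = ℕ → ℤ

sumℤ : List ℤ → ℤ
sumℤ = foldr _+_ 0ℤ

mono : ℕ → PS
mono a n = if a ≡ᵇ n then 1ℤ else 0ℤ

oneS : PS
oneS = mono 0

_⊕_ : PS → PS → PS
(f ⊕ g) n = f n + g n

_⊖_ : PS → PS → PS
(f ⊖ g) n = f n + - g n

_·ₛ_ : ℤ → PS → PS
(c ·ₛ f) n = c * f n

_⊛_ : PS → PS → PS
(f ⊛ g) n = sumℤ (map (λ i → f i * g (n ∸ i)) (upTo (suc n)))

sign : ℕ → ℤ
sign zero = 1ℤ
sign (suc m) = - sign m

prodS : ℕ → (ℕ → PS) → PS
prodS zero F = oneS
prodS (suc j) F = prodS j F ⊛ F j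

-- Infinite sum Σ_{j≥0} F j, for families where F j = O(q^j):
-- the coefficient of q^n only receives contributions from j ≤ n.
sumFam : (ℕ → PS) → PS
sumFam F n = sumℤ (map (λ j → F j n) (upTo (suc n)))

-- Infinite product Π_{r≥0} F r, for families where F r = 1 + O(q^(r+1)):
-- the coefficient of q^n is already determined by the first n factors.
prodInf : (ℕ → PS) → PS
prodInf F n = prodS n F n

-- 1/(1 - q^m) = Σ_{i≥0} q^(m i), used only for m ≥ 1
geom : ℕ → PS
geom m = sumFam (λ i → mono (i *ℕ m))

fac2 : ℕ → PS
fac2 r = oneS ⊖ mono (2 *ℕ suc r)

poch2 : ℕ → PS
poch2 j = prodS j fac2

poch2Inv : ℕ → PS
poch2Inv j = prodS j (λ r → geom (2 *ℕ suc r))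

poch2Inf : PS
poch2Inf = prodInf fac2

lhs : ℕ → PS
lhs k = (poch2Inf ⊛ poch2Inf)
        ⊛ sumFam (λ j → mono (2 *ℕ j +ℕ k) ⊛ (poch2Inv j ⊛ poch2Inv (j +ℕ k)))

-- RHS: Σ_{j≥k} (-1)^(j-k) q^(j(j+1)-k²), reindexed j = i + k
-- (exponent (i+k)(i+k+1) - k² ≥ i, so truncation in sumFam is valid)
rhs : ℕ → PS
rhs k = sumFam (λ i → sign i ·ₛ mono ((i +ℕ k) *ℕ suc (i +ℕ k) ∸ k *ℕ k))

{-# OPTIONS --safe #-}
module Submission where

-- Both sides X k satisfy X k + q^(2k+1) X (k+1) = q^k, and this recurrence has at most one solution,
-- since the coefficient of q^n in X k is fixed by the coefficients of X (k+1) below n.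
-- For the right-hand side the recurrence is the shift i ↦ i + 1 of its summation index. On the left,
-- with u k j = q^(2j+k) / ((q²;q²)_j (q²;q²)_(j+k)), the terms u k j + q^(2k+1) u (k+1) j telescope:
-- their sum over j ≤ N is q^k / ((q²;q²)_N (q²;q²)_(N+k+1)). As (q²;q²)_∞ agrees with both finite
-- products modulo q^(2N+2), multiplying by (q²;q²)_∞² gives q^k modulo q^(2N+2), for every N.

open import Algebra.Bundles using (CommutativeRing)
open import Algebra.Structures using (IsCommutativeRing)
import Algebra.Construct.Pointwise as Pointwise
import Algebra.Properties.CommutativeSemigroup as CommSemigroupProps
import Algebra.Solver.Ring as RingSolver
open import Algebra.Solver.Ring.AlmostCommutativeRing
  using (fromCommutativeRing; _-Raw-AlmostCommutative⟶_)
open import Data.Bool using (if_then_else_)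
open import Data.Integer as ℤ using (ℤ; _+_; _*_; -_; 0ℤ; 1ℤ)
import Data.Integer.Properties as ℤₚ
import Data.Integer.Tactic.RingSolver as ℤ-Solver
open import Data.List using (map; applyUpTo; upTo)
open import Data.List.Properties using (map-cong)
open import Data.Maybe using (Maybe; just; nothing)
open import Data.Product using (_,_)
open import Data.Nat as ℕ
  using (ℕ; zero; suc; _∸_; _≡ᵇ_; NonZero; _≤_; _<_; _≤′_; ≤′-refl; ≤′-step; _⊔_; z≤n; s≤s)
  renaming (_+_ to _+ℕ_; _*_ to _*ℕ_)
import Data.Nat.Properties as ℕₚ
open import Data.Nat.Tactic.RingSolver using (solve-∀)
open import Data.Sum using (inj₁; inj₂)
open import Function using (id; _∘_)
open import Relation.Binary.Bundles using (Setoid)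
open import Relation.Binary.PropositionalEquality
import Relation.Binary.Reasoning.Setoid as SetoidReasoning
open import Relation.Nullary using (yes; no)
open import Defs

open CommSemigroupProps ℤₚ.+-commutativeSemigroup using (interchange)
open import Algebra.Properties.AbelianGroup ℤₚ.+-0-abelianGroup using (∙-cancelʳ)

∑ : ℕ → (ℕ → ℤ) → ℤ
∑ zero    h = 0ℤ
∑ (suc m) h = h 0 + ∑ m (h ∘ suc)

sumℤ-applyUpTo : ∀ (h : ℕ → ℤ) s m → sumℤ (map h (applyUpTo s m)) ≡ ∑ m (h ∘ s)
sumℤ-applyUpTo h s zero    = refl
sumℤ-applyUpTo h s (suc m) = cong (h (s 0) +_) (sumℤ-applyUpTo h (s ∘ suc) m)

∑-+ : ∀ m h h′ → ∑ m (λ i → h i + h′ i) ≡ ∑ m h + ∑ m h′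
∑-+ zero    h h′ = refl
∑-+ (suc m) h h′ = trans (cong (h 0 + h′ 0 +_) (∑-+ m (h ∘ suc) (h′ ∘ suc)))
                         (interchange (h 0) (h′ 0) _ _)

∑-last : ∀ m h → ∑ (suc m) h ≡ ∑ m h + h m
∑-last zero    h = trans (ℤₚ.+-identityʳ (h 0)) (sym (ℤₚ.+-identityˡ (h 0)))
∑-last (suc m) h = trans (cong (h 0 +_) (∑-last m (h ∘ suc))) (sym (ℤₚ.+-assoc (h 0) _ _))

∑-tail : ∀ {t} m h → (∀ i → t ≤ i → h i ≡ 0ℤ) → t ≤ m → ∑ m h ≡ ∑ t h
∑-tail {zero}  zero    h h≡0 _         = refl
∑-tail {zero}  (suc m) h h≡0 _         =
  cong₂ _+_ (h≡0 0 z≤n) (∑-tail m (h ∘ suc) (λ i _ → h≡0 (suc i) z≤n) z≤n)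
∑-tail {suc t} (suc m) h h≡0 (s≤s t≤m) =
  cong (h 0 +_) (∑-tail m (h ∘ suc) (λ i t≤i → h≡0 (suc i) (s≤s t≤i)) t≤m)

-- The ring of formal power series

zeroS : PS
zeroS _ = 0ℤ

negS : PS → PS
negS f n = - f n

shift : PS → PS
shift f n = f (suc n)

-- The Cauchy product in recursive form, on which the ring laws are proved by induction on the degree.
conv : PS → PS → PS
conv f g zero    = f 0 * g 0
conv f g (suc n) = f 0 * g (suc n) + conv (shift f) g n

conv-∑ : ∀ f g n → conv f g n ≡ ∑ (suc n) (λ i → f i * g (n ∸ i))
conv-∑ f g zero    = sym (ℤₚ.+-identityʳ _)
conv-∑ f g (suc n) = cong (f 0 * g (suc n) +_) (conv-∑ (shift f) g n)

⊛≗conv : ∀ f g → f ⊛ g ≗ conv f g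
⊛≗conv f g n = trans (sumℤ-applyUpTo (λ i → f i * g (n ∸ i)) id (suc n)) (sym (conv-∑ f g n))

conv-congˡ : ∀ {f f′} g → f ≗ f′ → conv f g ≗ conv f′ g
conv-congˡ g f≗f′ zero    = cong (_* g 0) (f≗f′ 0)
conv-congˡ g f≗f′ (suc n) =
  cong₂ _+_ (cong (_* g (suc n)) (f≗f′ 0)) (conv-congˡ g (f≗f′ ∘ suc) n)

conv-congʳ : ∀ f {g g′} → g ≗ g′ → conv f g ≗ conv f g′
conv-congʳ f g≗g′ zero    = cong (f 0 *_) (g≗g′ 0)
conv-congʳ f g≗g′ (suc n) =
  cong₂ _+_ (cong (f 0 *_) (g≗g′ (suc n))) (conv-congʳ (shift f) g≗g′ n)

conv-zeroˡ : ∀ g → conv zeroS g ≗ zeroS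
conv-zeroˡ g zero    = refl
conv-zeroˡ g (suc n) = trans (ℤₚ.+-identityˡ _) (conv-zeroˡ g n)

conv-identityˡ : ∀ g → conv oneS g ≗ g
conv-identityˡ g zero    = ℤₚ.*-identityˡ (g 0)
conv-identityˡ g (suc n) =
  trans (cong₂ _+_ (ℤₚ.*-identityˡ (g (suc n))) (conv-zeroˡ g n)) (ℤₚ.+-identityʳ _)

conv-peelʳ : ∀ f g n → conv f g (suc n) ≡ conv f (shift g) n + f (suc n) * g 0
conv-peelʳ f g zero    = refl
conv-peelʳ f g (suc n) =
  trans (cong (f 0 * g (suc (suc n)) +_) (conv-peelʳ (shift f) g n))
        (sym (ℤₚ.+-assoc (f 0 * g (suc (suc n))) (conv (shift f) (shift g) n) (f (suc (suc n)) * g 0)))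

conv-comm : ∀ f g → conv f g ≗ conv g f
conv-comm f g zero    = ℤₚ.*-comm (f 0) (g 0)
conv-comm f g (suc n) = begin
  f 0 * g (suc n) + conv (shift f) g n
    ≡⟨ cong₂ _+_ (ℤₚ.*-comm (f 0) (g (suc n))) (conv-comm (shift f) g n) ⟩
  g (suc n) * f 0 + conv g (shift f) n
    ≡⟨ ℤₚ.+-comm (g (suc n) * f 0) (conv g (shift f) n) ⟩
  conv g (shift f) n + g (suc n) * f 0
    ≡⟨ conv-peelʳ g f n ⟨
  conv g f (suc n) ∎
  where open ≡-Reasoning

conv-distribʳ : ∀ h f g → conv (f ⊕ g) h ≗ conv f h ⊕ conv g h
conv-distribʳ h f g zero    = ℤₚ.*-distribʳ-+ (h 0) (f 0) (g 0)
conv-distribʳ h f g (suc n) =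
  trans (cong₂ _+_ (ℤₚ.*-distribʳ-+ (h (suc n)) (f 0) (g 0)) (conv-distribʳ h (shift f) (shift g) n))
        (interchange (f 0 * h (suc n)) (g 0 * h (suc n)) (conv (shift f) h n) (conv (shift g) h n))

conv-scalarˡ : ∀ c f g → conv (c ·ₛ f) g ≗ c ·ₛ conv f g
conv-scalarˡ c f g zero    = ℤₚ.*-assoc c (f 0) (g 0)
conv-scalarˡ c f g (suc n) =
  trans (cong₂ _+_ (ℤₚ.*-assoc c (f 0) (g (suc n))) (conv-scalarˡ c (shift f) g n))
        (sym (ℤₚ.*-distribˡ-+ c (f 0 * g (suc n)) (conv (shift f) g n)))

conv-assoc : ∀ f g h → conv (conv f g) h ≗ conv f (conv g h)
conv-assoc f g h zero    = ℤₚ.*-assoc (f 0) (g 0) (h 0)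
conv-assoc f g h (suc n) = begin
  f 0 * g 0 * h (suc n) + conv ((f 0 ·ₛ shift g) ⊕ conv (shift f) g) h n
    ≡⟨ cong (f 0 * g 0 * h (suc n) +_) (trans (conv-distribʳ h (f 0 ·ₛ shift g) (conv (shift f) g) n)
         (cong₂ _+_ (conv-scalarˡ (f 0) (shift g) h n) (conv-assoc (shift f) g h n))) ⟩
  f 0 * g 0 * h (suc n) + (f 0 * conv (shift g) h n + conv (shift f) (conv g h) n)
    ≡⟨ regroup (f 0) (g 0) (h (suc n)) (conv (shift g) h n) (conv (shift f) (conv g h) n) ⟩
  f 0 * (g 0 * h (suc n) + conv (shift g) h n) + conv (shift f) (conv g h) n ∎
  where
  open ≡-Reasoning
  regroup : ∀ a b c d e → a * b * c + (a * d + e) ≡ a * (b * c + d) + e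
  regroup = ℤ-Solver.solve-∀

⊛-cong : ∀ {f f′ g g′} → f ≗ f′ → g ≗ g′ → f ⊛ g ≗ f′ ⊛ g′
⊛-cong {f} {f′} {g} {g′} f≗f′ g≗g′ n = begin
  (f ⊛ g) n     ≡⟨ ⊛≗conv f g n ⟩
  conv f g n    ≡⟨ conv-congˡ g f≗f′ n ⟩
  conv f′ g n   ≡⟨ conv-congʳ f′ g≗g′ n ⟩
  conv f′ g′ n  ≡⟨ ⊛≗conv f′ g′ n ⟨
  (f′ ⊛ g′) n   ∎
  where open ≡-Reasoning

⊛-comm : ∀ f g → f ⊛ g ≗ g ⊛ f
⊛-comm f g n = trans (⊛≗conv f g n) (trans (conv-comm f g n) (sym (⊛≗conv g f n)))

⊛-assoc : ∀ f g h → (f ⊛ g) ⊛ h ≗ f ⊛ (g ⊛ h)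
⊛-assoc f g h n = begin
  ((f ⊛ g) ⊛ h) n        ≡⟨ ⊛≗conv (f ⊛ g) h n ⟩
  conv (f ⊛ g) h n       ≡⟨ conv-congˡ h (⊛≗conv f g) n ⟩
  conv (conv f g) h n    ≡⟨ conv-assoc f g h n ⟩
  conv f (conv g h) n    ≡⟨ conv-congʳ f (⊛≗conv g h) n ⟨
  conv f (g ⊛ h) n       ≡⟨ ⊛≗conv f (g ⊛ h) n ⟨
  (f ⊛ (g ⊛ h)) n        ∎
  where open ≡-Reasoning

⊛-identityˡ : ∀ f → oneS ⊛ f ≗ f
⊛-identityˡ f n = trans (⊛≗conv oneS f n) (conv-identityˡ f n)

⊛-identityʳ : ∀ f → f ⊛ oneS ≗ f
⊛-identityʳ f n = trans (⊛-comm f oneS n) (⊛-identityˡ f n)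

⊛-distribʳ : ∀ h f g → (f ⊕ g) ⊛ h ≗ (f ⊛ h) ⊕ (g ⊛ h)
⊛-distribʳ h f g n =
  trans (⊛≗conv (f ⊕ g) h n)
        (trans (conv-distribʳ h f g n) (sym (cong₂ _+_ (⊛≗conv f h n) (⊛≗conv g h n))))

⊛-distribˡ : ∀ h f g → h ⊛ (f ⊕ g) ≗ (h ⊛ f) ⊕ (h ⊛ g)
⊛-distribˡ h f g n = begin
  (h ⊛ (f ⊕ g)) n          ≡⟨ ⊛-comm h (f ⊕ g) n ⟩
  ((f ⊕ g) ⊛ h) n          ≡⟨ ⊛-distribʳ h f g n ⟩
  (f ⊛ h) n + (g ⊛ h) n    ≡⟨ cong₂ _+_ (⊛-comm f h n) (⊛-comm g h n) ⟩
  (h ⊛ f) n + (h ⊛ g) n    ∎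
  where open ≡-Reasoning

PS-isCommutativeRing : IsCommutativeRing _≗_ _⊕_ _⊛_ negS zeroS oneS
PS-isCommutativeRing = record
  { isRing = record
    { +-isAbelianGroup = Pointwise.isAbelianGroup ℕ ℤₚ.+-0-isAbelianGroup
    ; *-cong           = ⊛-cong
    ; *-assoc          = ⊛-assoc
    ; *-identity       = ⊛-identityˡ , ⊛-identityʳ
    ; distrib          = ⊛-distribˡ , ⊛-distribʳ
    }
  ; *-comm = ⊛-comm
  }

PS-commutativeRing : CommutativeRing _ _
PS-commutativeRing = record { isCommutativeRing = PS-isCommutativeRing }

-- Written so that constS 1ℤ unfolds to oneS: constants produced by the ring solver then match oneS.
constS : ℤ → PS
constS c n = if 0 ≡ᵇ n then c else 0ℤ

constS-homomorphism : ℤ.+-*-rawRing -Raw-AlmostCommutative⟶ fromCommutativeRing PS-commutativeRing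
constS-homomorphism = record
  { ⟦_⟧    = constS
  ; +-homo = λ a b → λ { zero → refl ; (suc n) → refl }
  ; *-homo = λ a b n → trans (constS-* a b n) (sym (⊛≗conv (constS a) (constS b) n))
  ; -‿homo = λ a → λ { zero → refl ; (suc n) → refl }
  ; 0-homo = λ { zero → refl ; (suc n) → refl }
  ; 1-homo = λ _ → refl
  }
  where
  constS-* : ∀ a b → constS (a * b) ≗ conv (constS a) (constS b)
  constS-* a b zero    = refl
  constS-* a b (suc n) =
    sym (trans (cong₂ _+_ (ℤₚ.*-zeroʳ a) (conv-zeroˡ (constS b) n)) (ℤₚ.+-identityʳ 0ℤ))

constS-≟ : ∀ a b → Maybe (constS a ≗ constS b)
constS-≟ a b with a ℤ.≟ b
... | yes refl = just (λ _ → refl)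
... | no _     = nothing

module PS-Solver =
  RingSolver ℤ.+-*-rawRing (fromCommutativeRing PS-commutativeRing) constS-homomorphism constS-≟

open CommutativeRing PS-commutativeRing
  using (-‿cong; *-commutativeSemigroup)
  renaming ( setoid to PS-setoid; +-cong to ⊕-cong; +-congˡ to ⊕-congˡ; +-congʳ to ⊕-congʳ
           ; *-congˡ to ⊛-congˡ; *-congʳ to ⊛-congʳ; zeroʳ to ⊛-zeroʳ)
open CommSemigroupProps *-commutativeSemigroup using () renaming (interchange to ⊛-interchange)

constS-neg : ∀ c → constS (- c) ≗ negS (constS c)
constS-neg = _-Raw-AlmostCommutative⟶_.-‿homo constS-homomorphism

·ₛ≗constS⊛ : ∀ c f → c ·ₛ f ≗ constS c ⊛ f
·ₛ≗constS⊛ c f n = sym (trans (⊛≗conv (constS c) f n) (conv-constS n))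
  where
  conv-constS : ∀ n → conv (constS c) f n ≡ c * f n
  conv-constS zero    = refl
  conv-constS (suc n) = trans (cong (c * f (suc n) +_) (conv-zeroˡ f n)) (ℤₚ.+-identityʳ _)

mono-+ : ∀ a b → mono (a +ℕ b) ≗ mono a ⊛ mono b
mono-+ zero    b n       = sym (⊛-identityˡ (mono b) n)
mono-+ (suc a) b zero    = sym (⊛≗conv (mono (suc a)) (mono b) 0)
mono-+ (suc a) b (suc n) = begin
  mono (a +ℕ b) n                       ≡⟨ mono-+ a b n ⟩
  (mono a ⊛ mono b) n                   ≡⟨ ⊛≗conv (mono a) (mono b) n ⟩
  conv (mono a) (mono b) n              ≡⟨ ℤₚ.+-identityˡ _ ⟨
  conv (mono (suc a)) (mono b) (suc n)  ≡⟨ ⊛≗conv (mono (suc a)) (mono b) (suc n) ⟨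
  (mono (suc a) ⊛ mono b) (suc n)       ∎
  where open ≡-Reasoning

infix 25 p^_

p^_ : ℕ → PS
p^ j = mono (2 *ℕ j)

-- Congruences modulo powers of q

infix 4 _≈_mod-q^_ q^_∣_

_≈_mod-q^_ : PS → PS → ℕ → Set
f ≈ g mod-q^ N = ∀ n → n < N → f n ≡ g n

q^_∣_ : ℕ → PS → Set
q^ a ∣ f = f ≈ zeroS mod-q^ a

mod-setoid : ℕ → Setoid _ _
mod-setoid N = record
  { Carrier       = PS
  ; _≈_           = _≈_mod-q^ N
  ; isEquivalence = record
    { refl  = λ _ _ → refl
    ; sym   = λ f≈g n n<N → sym (f≈g n n<N)
    ; trans = λ f≈g g≈h n n<N → trans (f≈g n n<N) (g≈h n n<N)
    }
  }

≗⇒mod : ∀ {f g} N → f ≗ g → f ≈ g mod-q^ N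
≗⇒mod N f≗g n _ = f≗g n

mod-weaken : ∀ {M N f g} → M ≤ N → f ≈ g mod-q^ N → f ≈ g mod-q^ M
mod-weaken M≤N f≈g n n<M = f≈g n (ℕₚ.<-≤-trans n<M M≤N)

⊕-cong-mod : ∀ {N f f′ g g′} → f ≈ f′ mod-q^ N → g ≈ g′ mod-q^ N →
             f ⊕ g ≈ f′ ⊕ g′ mod-q^ N
⊕-cong-mod f≈f′ g≈g′ n n<N = cong₂ _+_ (f≈f′ n n<N) (g≈g′ n n<N)

⊖-∣ : ∀ {N h} f → q^ N ∣ h → f ⊖ h ≈ f mod-q^ N
⊖-∣ f h∣ n n<N = trans (cong (λ x → f n + - x) (h∣ n n<N)) (ℤₚ.+-identityʳ (f n))

zeroˡ-*-≡ : ∀ {a x y} → a ≡ 0ℤ → a * x ≡ a * y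
zeroˡ-*-≡ refl = refl

conv-mod : ∀ {a N} h {f g} → q^ a ∣ h → f ≈ g mod-q^ N → conv h f ≈ conv h g mod-q^ (a +ℕ N)
conv-mod {zero}  h h∣ f≈g zero    n<N = cong (h 0 *_) (f≈g 0 n<N)
conv-mod {zero}  h h∣ f≈g (suc n) n<N =
  cong₂ _+_ (cong (h 0 *_) (f≈g (suc n) n<N))
            (conv-mod {zero} (shift h) (λ _ ()) f≈g n (ℕₚ.<-trans (ℕₚ.n<1+n n) n<N))
conv-mod {suc a} h h∣ f≈g zero    _          = zeroˡ-*-≡ (h∣ 0 (s≤s z≤n))
conv-mod {suc a} h h∣ f≈g (suc n) (s≤s n<aN) =
  cong₂ _+_ (zeroˡ-*-≡ (h∣ 0 (s≤s z≤n)))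
            (conv-mod {a} (shift h) (λ m m<a → h∣ (suc m) (s≤s m<a)) f≈g n n<aN)

⊛-mod : ∀ {a N} h {f g} → q^ a ∣ h → f ≈ g mod-q^ N → h ⊛ f ≈ h ⊛ g mod-q^ (a +ℕ N)
⊛-mod h {f} {g} h∣ f≈g n n<aN =
  trans (⊛≗conv h f n) (trans (conv-mod h h∣ f≈g n n<aN) (sym (⊛≗conv h g n)))

⊛-cong-mod : ∀ {N f f′ g g′} → f ≈ f′ mod-q^ N → g ≈ g′ mod-q^ N →
             f ⊛ g ≈ f′ ⊛ g′ mod-q^ N
⊛-cong-mod {N} {f} {f′} {g} {g′} f≈f′ g≈g′ = begin
  f ⊛ g    ≈⟨ ⊛-mod {0} f (λ _ ()) g≈g′ ⟩
  f ⊛ g′   ≈⟨ ≗⇒mod N (⊛-comm f g′) ⟩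
  g′ ⊛ f   ≈⟨ ⊛-mod {0} g′ (λ _ ()) f≈f′ ⟩
  g′ ⊛ f′  ≈⟨ ≗⇒mod N (⊛-comm g′ f′) ⟩
  f′ ⊛ g′  ∎
  where open SetoidReasoning (mod-setoid N)

q^∣mono : ∀ a → q^ a ∣ mono a
q^∣mono (suc a) zero    _         = refl
q^∣mono (suc a) (suc n) (s≤s n<a) = q^∣mono a n n<a

∣-⊛ʳ : ∀ {a} f {g} → q^ a ∣ g → q^ a ∣ f ⊛ g
∣-⊛ʳ f g∣ n n<a = trans (⊛-mod {0} f (λ _ ()) g∣ n n<a) (⊛-zeroʳ f n)

∣-⊛ˡ : ∀ {a f} g → q^ a ∣ f → q^ a ∣ f ⊛ g
∣-⊛ˡ {f = f} g f∣ n n<a = trans (⊛-comm f g n) (∣-⊛ʳ g f∣ n n<a)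

∣-·ₛ : ∀ {a f} c → q^ a ∣ f → q^ a ∣ c ·ₛ f
∣-·ₛ c f∣ n n<a = trans (cong (c *_) (f∣ n n<a)) (ℤₚ.*-zeroʳ c)

∑ₛ : ℕ → (ℕ → PS) → PS
∑ₛ M F n = ∑ M (λ j → F j n)

∑ₛ-⊛ : ∀ g M F → g ⊛ ∑ₛ M F ≗ ∑ₛ M (λ j → g ⊛ F j)
∑ₛ-⊛ g zero    F   = ⊛-zeroʳ g
∑ₛ-⊛ g (suc M) F n =
  trans (⊛-distribˡ g (F 0) (∑ₛ M (F ∘ suc)) n)
        (cong ((g ⊛ F 0) n +_) (∑ₛ-⊛ g M (F ∘ suc) n))

∑ₛ-telescope : ∀ {F T : ℕ → PS} → F 0 ≗ T 0 → (∀ j → T j ⊕ F (suc j) ≗ T (suc j)) →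
               ∀ N → ∑ₛ (suc N) F ≗ T N
∑ₛ-telescope {F} {T} base step zero    n = trans (ℤₚ.+-identityʳ (F 0 n)) (base n)
∑ₛ-telescope {F} {T} base step (suc N) n =
  trans (∑-last (suc N) (λ j → F j n))
        (trans (cong (_+ F (suc N) n) (∑ₛ-telescope {F} {T} base step N n)) (step N n))

Summable : (ℕ → PS) → Set
Summable F = ∀ j → q^ j ∣ F j

sumFam-coeff : ∀ F n → sumFam F n ≡ ∑ₛ (suc n) F n
sumFam-coeff F n = sumℤ-applyUpTo (λ j → F j n) id (suc n)

sumFam-cong : ∀ {F G} → (∀ j → F j ≗ G j) → sumFam F ≗ sumFam G
sumFam-cong F≗G n = cong sumℤ (map-cong (λ j → F≗G j n) (upTo (suc n)))

sumFam-⊕ : ∀ F G → sumFam F ⊕ sumFam G ≗ sumFam (λ j → F j ⊕ G j)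
sumFam-⊕ F G n = begin
  sumFam F n + sumFam G n                   ≡⟨ cong₂ _+_ (sumFam-coeff F n) (sumFam-coeff G n) ⟩
  ∑ₛ (suc n) F n + ∑ₛ (suc n) G n           ≡⟨ ∑-+ (suc n) (λ j → F j n) (λ j → G j n) ⟨
  ∑ₛ (suc n) (λ j → F j ⊕ G j) n            ≡⟨ sumFam-coeff (λ j → F j ⊕ G j) n ⟨
  sumFam (λ j → F j ⊕ G j) n                ∎
  where open ≡-Reasoning

sumFam-truncate : ∀ {F M N} → Summable F → (∀ j → M ≤ j → q^ N ∣ F j) →
                  sumFam F ≈ ∑ₛ M F mod-q^ N
sumFam-truncate {F} {M} F-summable F-small n n<N = begin
  sumFam F n                   ≡⟨ sumFam-coeff F n ⟩
  ∑ (suc n) (λ j → F j n)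
    ≡⟨ ∑-tail (M ⊔ suc n) _ (λ j n<j → F-summable j n n<j) (ℕₚ.m≤n⊔m M (suc n)) ⟨
  ∑ (M ⊔ suc n) (λ j → F j n)
    ≡⟨ ∑-tail (M ⊔ suc n) _ (λ j M≤j → F-small j M≤j n n<N) (ℕₚ.m≤m⊔n M (suc n)) ⟩
  ∑ M (λ j → F j n)            ∎
  where open ≡-Reasoning

sumFam≈∑ₛ : ∀ {F} → Summable F → ∀ {M N} → N ≤ M → sumFam F ≈ ∑ₛ M F mod-q^ N
sumFam≈∑ₛ F-summable N≤M =
  sumFam-truncate F-summable (λ j M≤j → mod-weaken (ℕₚ.≤-trans N≤M M≤j) (F-summable j))

sumFam-⊛ : ∀ g {F} → Summable F → g ⊛ sumFam F ≗ sumFam (λ j → g ⊛ F j)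
sumFam-⊛ g {F} F-summable n = coefficients n ℕₚ.≤-refl
  where
  open SetoidReasoning (mod-setoid (suc n))
  coefficients : g ⊛ sumFam F ≈ sumFam (λ j → g ⊛ F j) mod-q^ suc n
  coefficients = begin
    g ⊛ sumFam F
      ≈⟨ ⊛-cong-mod {f = g} (λ _ _ → refl) (sumFam≈∑ₛ F-summable ℕₚ.≤-refl) ⟩
    g ⊛ ∑ₛ (suc n) F
      ≈⟨ ≗⇒mod (suc n) (∑ₛ-⊛ g (suc n) F) ⟩
    ∑ₛ (suc n) (λ j → g ⊛ F j)
      ≈⟨ sumFam≈∑ₛ (λ j → ∣-⊛ʳ g (F-summable j)) ℕₚ.≤-refl ⟨
    sumFam (λ j → g ⊛ F j) ∎

sumFam-unfold : ∀ {F} → Summable F → sumFam F ≗ F 0 ⊕ sumFam (F ∘ suc)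
sumFam-unfold {F} F-summable n = coefficients n ℕₚ.≤-refl
  where
  open SetoidReasoning (mod-setoid (suc n))
  tail-summable : Summable (F ∘ suc)
  tail-summable j = mod-weaken (ℕₚ.n≤1+n j) (F-summable (suc j))
  coefficients : sumFam F ≈ F 0 ⊕ sumFam (F ∘ suc) mod-q^ suc n
  coefficients = begin
    sumFam F
      ≈⟨ sumFam≈∑ₛ F-summable (ℕₚ.n≤1+n (suc n)) ⟩
    F 0 ⊕ ∑ₛ (suc n) (F ∘ suc)
      ≈⟨ ⊕-cong-mod {f = F 0} (λ _ _ → refl) (sumFam≈∑ₛ tail-summable ℕₚ.≤-refl) ⟨
    F 0 ⊕ sumFam (F ∘ suc) ∎

-- Geometric series and q-Pochhammer symbols

geom-summable : ∀ m .{{_ : NonZero m}} → Summable (λ i → mono (i *ℕ m))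
geom-summable m i = mod-weaken (ℕₚ.m≤m*n i m) (q^∣mono (i *ℕ m))

geom-unfold : ∀ m .{{_ : NonZero m}} → geom m ≗ oneS ⊕ (mono m ⊛ geom m)
geom-unfold m = begin
  geom m
    ≈⟨ sumFam-unfold (geom-summable m) ⟩
  oneS ⊕ sumFam (λ i → mono (m +ℕ i *ℕ m))
    ≈⟨ ⊕-congˡ {oneS} (sumFam-cong (λ i → mono-+ m (i *ℕ m))) ⟩
  oneS ⊕ sumFam (λ i → mono m ⊛ mono (i *ℕ m))
    ≈⟨ ⊕-congˡ {oneS} (sumFam-⊛ (mono m) (geom-summable m)) ⟨
  oneS ⊕ (mono m ⊛ geom m) ∎
  where open SetoidReasoning PS-setoid

geom-inverse : ∀ m .{{_ : NonZero m}} → geom m ⊛ (oneS ⊖ mono m) ≗ oneS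
geom-inverse m = begin
  g ⊛ (oneS ⊖ x)              ≈⟨ expand g x ⟩
  g ⊖ (x ⊛ g)                 ≈⟨ ⊕-congʳ (geom-unfold m) ⟩
  (oneS ⊕ (x ⊛ g)) ⊖ (x ⊛ g)  ≈⟨ cancel g x ⟩
  oneS                        ∎
  where
  g = geom m
  x = mono m
  open SetoidReasoning PS-setoid
  open PS-Solver
  expand : ∀ a b → a ⊛ (oneS ⊖ b) ≗ a ⊖ (b ⊛ a)
  expand = solve 2 (λ a b → a :* (con 1ℤ :- b) := a :- b :* a) (λ _ → refl)
  cancel : ∀ a b → (oneS ⊕ (b ⊛ a)) ⊖ (b ⊛ a) ≗ oneS
  cancel = solve 2 (λ a b → (con 1ℤ :+ b :* a) :- b :* a := con 1ℤ) (λ _ → refl)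

prodS-stable : ∀ {N a b} F → (∀ r → a ≤ r → F r ≈ oneS mod-q^ N) → a ≤′ b →
               prodS a F ≈ prodS b F mod-q^ N
prodS-stable         F F≈1 ≤′-refl             = λ _ _ → refl
prodS-stable {N} {a} F F≈1 (≤′-step {b} a≤′b) = begin
  prodS a F         ≈⟨ prodS-stable F F≈1 a≤′b ⟩
  prodS b F         ≈⟨ ≗⇒mod N (⊛-identityʳ (prodS b F)) ⟨
  prodS b F ⊛ oneS  ≈⟨ ⊛-cong-mod {f = prodS b F} (λ _ _ → refl) (F≈1 b (ℕₚ.≤′⇒≤ a≤′b)) ⟨
  prodS b F ⊛ F b   ∎
  where open SetoidReasoning (mod-setoid N)

-- The coefficient of q^n in prodInf F is that of prodS n F; both prodS n F and prodS a F
-- agree with prodS (n ⊔ a) F there.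
prodInf-approx : ∀ (e : ℕ → ℕ) {F} → (∀ {r s} → r ≤ s → e r ≤ e s) → (∀ r → r < e r) →
                 (∀ r → F r ≈ oneS mod-q^ e r) → ∀ a → prodInf F ≈ prodS a F mod-q^ e a
prodInf-approx e {F} e-mono r<e F≈1 a n n<ea = begin
  prodS n F n        ≡⟨ prodS-stable F (≈1-from n) (ℕₚ.≤⇒≤′ (ℕₚ.m≤m⊔n n a)) n (r<e n) ⟩
  prodS (n ⊔ a) F n  ≡⟨ prodS-stable F (≈1-from a) (ℕₚ.≤⇒≤′ (ℕₚ.m≤n⊔m n a)) n n<ea ⟨
  prodS a F n        ∎
  where
  open ≡-Reasoning
  ≈1-from : ∀ b r → b ≤ r → F r ≈ oneS mod-q^ e b
  ≈1-from b r b≤r = mod-weaken (e-mono b≤r) (F≈1 r)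

fac2≈1 : ∀ r → fac2 r ≈ oneS mod-q^ (2 *ℕ suc r)
fac2≈1 r = ⊖-∣ oneS (q^∣mono (2 *ℕ suc r))

poch2Inf≈poch2 : ∀ j → poch2Inf ≈ poch2 j mod-q^ (2 *ℕ suc j)
poch2Inf≈poch2 = prodInf-approx (λ r → 2 *ℕ suc r) (λ r≤s → ℕₚ.*-monoʳ-≤ 2 (s≤s r≤s))
                                (λ r → s≤s (ℕₚ.m≤m+n r _)) fac2≈1

poch2Inv-step : ∀ j → poch2Inv (suc j) ⊛ fac2 j ≗ poch2Inv j
poch2Inv-step j = begin
  (poch2Inv j ⊛ geom (2 *ℕ suc j)) ⊛ fac2 j  ≈⟨ ⊛-assoc (poch2Inv j) (geom (2 *ℕ suc j)) (fac2 j) ⟩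
  poch2Inv j ⊛ (geom (2 *ℕ suc j) ⊛ fac2 j)  ≈⟨ ⊛-congˡ {poch2Inv j} (geom-inverse (2 *ℕ suc j)) ⟩
  poch2Inv j ⊛ oneS                          ≈⟨ ⊛-identityʳ (poch2Inv j) ⟩
  poch2Inv j                                 ∎
  where open SetoidReasoning PS-setoid

poch2-⊛-poch2Inv : ∀ j → poch2 j ⊛ poch2Inv j ≗ oneS
poch2-⊛-poch2Inv zero    = ⊛-identityˡ oneS
poch2-⊛-poch2Inv (suc j) = begin
  (poch2 j ⊛ fac2 j) ⊛ (poch2Inv j ⊛ geom (2 *ℕ suc j))
    ≈⟨ ⊛-interchange (poch2 j) (fac2 j) (poch2Inv j) (geom (2 *ℕ suc j)) ⟩
  (poch2 j ⊛ poch2Inv j) ⊛ (fac2 j ⊛ geom (2 *ℕ suc j))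
    ≈⟨ ⊛-cong (poch2-⊛-poch2Inv j)
              (λ n → trans (⊛-comm (fac2 j) (geom (2 *ℕ suc j)) n) (geom-inverse (2 *ℕ suc j) n)) ⟩
  oneS ⊛ oneS
    ≈⟨ ⊛-identityˡ oneS ⟩
  oneS ∎
  where open SetoidReasoning PS-setoid

poch2Inf-⊛-poch2Inv : ∀ j → poch2Inf ⊛ poch2Inv j ≈ oneS mod-q^ (2 *ℕ suc j)
poch2Inf-⊛-poch2Inv j n n<N =
  trans (⊛-cong-mod {g = poch2Inv j} (poch2Inf≈poch2 j) (λ _ _ → refl) n n<N) (poch2-⊛-poch2Inv j n)

poch2Inv-split : ∀ i k →
  poch2Inv (i +ℕ k) ≗ poch2Inv (suc (i +ℕ k)) ⊛ (oneS ⊖ (p^ i ⊛ p^ (suc k)))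
poch2Inv-split i k n =
  trans (sym (poch2Inv-step (i +ℕ k) n))
        (⊛-congˡ {poch2Inv (suc (i +ℕ k))} (⊕-congˡ {oneS} (-‿cong p^-split)) n)
  where
  exponent : ∀ i k → 2 *ℕ suc (i +ℕ k) ≡ 2 *ℕ i +ℕ 2 *ℕ suc k
  exponent = solve-∀
  p^-split : p^ (suc (i +ℕ k)) ≗ p^ i ⊛ p^ (suc k)
  p^-split m = trans (cong (λ e → mono e m) (exponent i k)) (mono-+ (2 *ℕ i) (2 *ℕ suc k) m)

-- The left-hand side

lhsTerm : ℕ → ℕ → PS
lhsTerm k j = mono (2 *ℕ j +ℕ k) ⊛ (poch2Inv j ⊛ poch2Inv (j +ℕ k))

lhsTerm₂ : ℕ → ℕ → PS
lhsTerm₂ k j = lhsTerm k j ⊕ (mono (suc (2 *ℕ k)) ⊛ lhsTerm (suc k) j)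

j≤2j+k : ∀ j k → j ≤ 2 *ℕ j +ℕ k
j≤2j+k j k = ℕₚ.≤-trans (ℕₚ.m≤m+n j (j +ℕ 0)) (ℕₚ.m≤m+n (2 *ℕ j) k)

q^∣lhsTerm : ∀ k j → q^ (2 *ℕ j +ℕ k) ∣ lhsTerm k j
q^∣lhsTerm k j = ∣-⊛ˡ (poch2Inv j ⊛ poch2Inv (j +ℕ k)) (q^∣mono (2 *ℕ j +ℕ k))

q^∣lhsTerm₂ : ∀ k j → q^ (2 *ℕ j +ℕ k) ∣ lhsTerm₂ k j
q^∣lhsTerm₂ k j =
  ⊕-cong-mod (q^∣lhsTerm k j)
             (mod-weaken (ℕₚ.+-monoʳ-≤ (2 *ℕ j) (ℕₚ.n≤1+n k))
                         (∣-⊛ʳ (mono (suc (2 *ℕ k))) (q^∣lhsTerm (suc k) j)))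

lhs-pair : ∀ k →
  lhs k ⊕ (mono (suc (2 *ℕ k)) ⊛ lhs (suc k)) ≗ (poch2Inf ⊛ poch2Inf) ⊛ sumFam (lhsTerm₂ k)
lhs-pair k = begin
  (P ⊛ sumFam (lhsTerm k)) ⊕ (M ⊛ (P ⊛ sumFam (lhsTerm (suc k))))
    ≈⟨ factor P M (sumFam (lhsTerm k)) (sumFam (lhsTerm (suc k))) ⟩
  P ⊛ (sumFam (lhsTerm k) ⊕ (M ⊛ sumFam (lhsTerm (suc k))))
    ≈⟨ ⊛-congˡ {P} (⊕-congˡ {sumFam (lhsTerm k)} (sumFam-⊛ M lhsTerm-summable)) ⟩
  P ⊛ (sumFam (lhsTerm k) ⊕ sumFam (λ j → M ⊛ lhsTerm (suc k) j))
    ≈⟨ ⊛-congˡ {P} (sumFam-⊕ (lhsTerm k) (λ j → M ⊛ lhsTerm (suc k) j)) ⟩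
  P ⊛ sumFam (lhsTerm₂ k) ∎
  where
  P = poch2Inf ⊛ poch2Inf
  M = mono (suc (2 *ℕ k))
  lhsTerm-summable : Summable (lhsTerm (suc k))
  lhsTerm-summable j = mod-weaken (j≤2j+k j (suc k)) (q^∣lhsTerm (suc k) j)
  open SetoidReasoning PS-setoid
  open PS-Solver
  factor : ∀ p m a b → (p ⊛ a) ⊕ (m ⊛ (p ⊛ b)) ≗ p ⊛ (a ⊕ (m ⊛ b))
  factor = solve 4 (λ p m a b → p :* a :+ m :* (p :* b) := p :* (a :+ m :* b)) (λ _ → refl)

lhsTerm₂-factor : ∀ k j → lhsTerm₂ k j ≗
  ((mono k ⊛ p^ j) ⊛ poch2Inv j)
    ⊛ (poch2Inv (suc (j +ℕ k)) ⊛ ((oneS ⊖ (p^ j ⊛ p^ (suc k))) ⊕ p^ (suc k)))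
lhsTerm₂-factor k j = begin
  (mono (2 *ℕ j +ℕ k) ⊛ (a ⊛ poch2Inv (j +ℕ k)))
    ⊕ (M ⊛ (mono (2 *ℕ j +ℕ suc k) ⊛ (a ⊛ poch2Inv (j +ℕ suc k))))
    ≈⟨ ⊕-cong (⊛-cong (mono-+ (2 *ℕ j) k) (⊛-congˡ {a} (poch2Inv-split j k))) second-term ⟩
  ((x ⊛ Q) ⊛ (a ⊛ (B ⊛ (oneS ⊖ (x ⊛ y))))) ⊕ (((Q ⊛ x) ⊛ y) ⊛ (a ⊛ B))
    ≈⟨ rearrange Q x y a B ⟩
  ((Q ⊛ x) ⊛ a) ⊛ (B ⊛ ((oneS ⊖ (x ⊛ y)) ⊕ y)) ∎
  where
  open SetoidReasoning PS-setoid
  open PS-Solver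
  Q = mono k
  x = p^ j
  y = p^ (suc k)
  a = poch2Inv j
  B = poch2Inv (suc (j +ℕ k))
  M = mono (suc (2 *ℕ k))
  exponent : ∀ j k → suc (2 *ℕ k) +ℕ (2 *ℕ j +ℕ suc k) ≡ (k +ℕ 2 *ℕ j) +ℕ 2 *ℕ suc k
  exponent = solve-∀
  monos : M ⊛ mono (2 *ℕ j +ℕ suc k) ≗ (Q ⊛ x) ⊛ y
  monos = begin
    M ⊛ mono (2 *ℕ j +ℕ suc k)                        ≈⟨ mono-+ (suc (2 *ℕ k)) (2 *ℕ j +ℕ suc k) ⟨
    mono (suc (2 *ℕ k) +ℕ (2 *ℕ j +ℕ suc k))         ≈⟨ cong-app (cong mono (exponent j k)) ⟩
    mono ((k +ℕ 2 *ℕ j) +ℕ 2 *ℕ suc k)                ≈⟨ mono-+ (k +ℕ 2 *ℕ j) (2 *ℕ suc k) ⟩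
    mono (k +ℕ 2 *ℕ j) ⊛ y                            ≈⟨ ⊛-congʳ {y} (mono-+ k (2 *ℕ j)) ⟩
    (Q ⊛ x) ⊛ y                                       ∎
  second-term : M ⊛ (mono (2 *ℕ j +ℕ suc k) ⊛ (a ⊛ poch2Inv (j +ℕ suc k))) ≗ ((Q ⊛ x) ⊛ y) ⊛ (a ⊛ B)
  second-term n =
    trans (sym (⊛-assoc M (mono (2 *ℕ j +ℕ suc k)) (a ⊛ poch2Inv (j +ℕ suc k)) n))
          (⊛-cong monos (⊛-congˡ {a} (λ m → cong (λ i → poch2Inv i m) (ℕₚ.+-suc j k))) n)
  rearrange : ∀ Q x y a B →
    ((x ⊛ Q) ⊛ (a ⊛ (B ⊛ (oneS ⊖ (x ⊛ y))))) ⊕ (((Q ⊛ x) ⊛ y) ⊛ (a ⊛ B)) ≗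
    ((Q ⊛ x) ⊛ a) ⊛ (B ⊛ ((oneS ⊖ (x ⊛ y)) ⊕ y))
  rearrange = solve 5 (λ Q x y a B →
    (x :* Q) :* (a :* (B :* (con 1ℤ :- x :* y))) :+ ((Q :* x) :* y) :* (a :* B) :=
    ((Q :* x) :* a) :* (B :* ((con 1ℤ :- x :* y) :+ y))) (λ _ → refl)

lhs-telescope : ∀ k N →
  ∑ₛ (suc N) (lhsTerm₂ k) ≗ mono k ⊛ (poch2Inv N ⊛ poch2Inv (suc (N +ℕ k)))
lhs-telescope k = ∑ₛ-telescope {lhsTerm₂ k} {T} base step
  where
  open SetoidReasoning PS-setoid
  open PS-Solver
  Q = mono k
  y = p^ (suc k)
  T : ℕ → PS
  T N = Q ⊛ (poch2Inv N ⊛ poch2Inv (suc (N +ℕ k)))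
  collapse : ∀ Q y B → ((Q ⊛ oneS) ⊛ oneS) ⊛ (B ⊛ ((oneS ⊖ (oneS ⊛ y)) ⊕ y)) ≗ Q ⊛ (oneS ⊛ B)
  collapse = solve 3 (λ Q y B →
    ((Q :* con 1ℤ) :* con 1ℤ) :* (B :* ((con 1ℤ :- con 1ℤ :* y) :+ y)) := Q :* (con 1ℤ :* B))
    (λ _ → refl)
  telescoping : ∀ Q x y A B →
    (Q ⊛ ((A ⊛ (oneS ⊖ x)) ⊛ (B ⊛ (oneS ⊖ (x ⊛ y)))))
      ⊕ (((Q ⊛ x) ⊛ A) ⊛ (B ⊛ ((oneS ⊖ (x ⊛ y)) ⊕ y)))
    ≗ Q ⊛ (A ⊛ B)
  telescoping = solve 5 (λ Q x y A B →
    Q :* ((A :* (con 1ℤ :- x)) :* (B :* (con 1ℤ :- x :* y)))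
      :+ ((Q :* x) :* A) :* (B :* ((con 1ℤ :- x :* y) :+ y))
    := Q :* (A :* B)) (λ _ → refl)
  base : lhsTerm₂ k 0 ≗ T 0
  base n = trans (lhsTerm₂-factor k 0 n) (collapse Q y (poch2Inv (suc k)) n)
  step : ∀ N → T N ⊕ lhsTerm₂ k (suc N) ≗ T (suc N)
  step N = begin
    (Q ⊛ (poch2Inv N ⊛ poch2Inv (suc (N +ℕ k)))) ⊕ lhsTerm₂ k (suc N)
      ≈⟨ ⊕-cong (⊛-congˡ {Q} (⊛-cong (λ n → sym (poch2Inv-step N n)) (poch2Inv-split (suc N) k)))
                (lhsTerm₂-factor k (suc N)) ⟩
    (Q ⊛ ((A ⊛ (oneS ⊖ x)) ⊛ (B ⊛ (oneS ⊖ (x ⊛ y)))))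
      ⊕ (((Q ⊛ x) ⊛ A) ⊛ (B ⊛ ((oneS ⊖ (x ⊛ y)) ⊕ y)))
      ≈⟨ telescoping Q x y A B ⟩
    Q ⊛ (A ⊛ B) ∎
    where
    x = p^ (suc N)
    A = poch2Inv (suc N)
    B = poch2Inv (suc (suc N +ℕ k))

lhsTerm₂-truncate : ∀ k N → sumFam (lhsTerm₂ k) ≈ ∑ₛ (suc N) (lhsTerm₂ k) mod-q^ (2 *ℕ suc N)
lhsTerm₂-truncate k N =
  sumFam-truncate (λ j → mod-weaken (j≤2j+k j k) (q^∣lhsTerm₂ k j))
                  (λ j N<j → mod-weaken (ℕₚ.≤-trans (ℕₚ.*-monoʳ-≤ 2 N<j) (ℕₚ.m≤m+n (2 *ℕ j) k))
                                        (q^∣lhsTerm₂ k j))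

lhs-recurrence : ∀ k → lhs k ⊕ (mono (suc (2 *ℕ k)) ⊛ lhs (suc k)) ≗ mono k
lhs-recurrence k n = coefficients n (s≤s (ℕₚ.m≤m+n n _))
  where
  open SetoidReasoning (mod-setoid (2 *ℕ suc n))
  open PS-Solver
  P = poch2Inf
  G = poch2Inv n
  G′ = poch2Inv (suc (n +ℕ k))
  regroup : ∀ P Q G G′ → (P ⊛ P) ⊛ (Q ⊛ (G ⊛ G′)) ≗ Q ⊛ ((P ⊛ G) ⊛ (P ⊛ G′))
  regroup = solve 4 (λ P Q G G′ → (P :* P) :* (Q :* (G :* G′)) := Q :* ((P :* G) :* (P :* G′)))
                    (λ _ → refl)
  coefficients : lhs k ⊕ (mono (suc (2 *ℕ k)) ⊛ lhs (suc k)) ≈ mono k mod-q^ (2 *ℕ suc n)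
  coefficients = begin
    lhs k ⊕ (mono (suc (2 *ℕ k)) ⊛ lhs (suc k))
      ≈⟨ ≗⇒mod _ (lhs-pair k) ⟩
    (P ⊛ P) ⊛ sumFam (lhsTerm₂ k)
      ≈⟨ ⊛-cong-mod {f = P ⊛ P} (λ _ _ → refl) (lhsTerm₂-truncate k n) ⟩
    (P ⊛ P) ⊛ ∑ₛ (suc n) (lhsTerm₂ k)
      ≈⟨ ≗⇒mod _ (⊛-congˡ {P ⊛ P} (lhs-telescope k n)) ⟩
    (P ⊛ P) ⊛ (mono k ⊛ (G ⊛ G′))
      ≈⟨ ≗⇒mod _ (regroup P (mono k) G G′) ⟩
    mono k ⊛ ((P ⊛ G) ⊛ (P ⊛ G′))
      ≈⟨ ⊛-cong-mod {f = mono k} (λ _ _ → refl)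
           (⊛-cong-mod (poch2Inf-⊛-poch2Inv n)
                       (mod-weaken (ℕₚ.*-monoʳ-≤ 2 (s≤s (ℕₚ.m≤n⇒m≤1+n (ℕₚ.m≤m+n n k))))
                                   (poch2Inf-⊛-poch2Inv (suc (n +ℕ k))))) ⟩
    mono k ⊛ (oneS ⊛ oneS)
      ≈⟨ ≗⇒mod _ (λ m → trans (⊛-congˡ {mono k} (⊛-identityˡ oneS) m) (⊛-identityʳ (mono k) m)) ⟩
    mono k ∎

-- The right-hand side

rhsExponent : ℕ → ℕ → ℕ
rhsExponent k i = (i +ℕ k) *ℕ suc (i +ℕ k) ∸ k *ℕ k

rhsTerm : ℕ → ℕ → PS
rhsTerm k i = sign i ·ₛ mono (rhsExponent k i)

rhsExponent-closed : ∀ k i → rhsExponent k i ≡ k +ℕ i *ℕ suc (i +ℕ 2 *ℕ k)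
rhsExponent-closed k i = trans (cong (_∸ k *ℕ k) (expand k i)) (ℕₚ.m+n∸n≡m _ (k *ℕ k))
  where
  expand : ∀ k i → (i +ℕ k) *ℕ suc (i +ℕ k) ≡ (k +ℕ i *ℕ suc (i +ℕ 2 *ℕ k)) +ℕ k *ℕ k
  expand = solve-∀

rhsExponent-suc : ∀ k i → rhsExponent k (suc i) ≡ suc (2 *ℕ k) +ℕ rhsExponent (suc k) i
rhsExponent-suc k i = begin
  rhsExponent k (suc i)
    ≡⟨ rhsExponent-closed k (suc i) ⟩
  k +ℕ suc i *ℕ suc (suc i +ℕ 2 *ℕ k)
    ≡⟨ shift-index k i ⟩
  suc (2 *ℕ k) +ℕ (suc k +ℕ i *ℕ suc (i +ℕ 2 *ℕ suc k))
    ≡⟨ cong (suc (2 *ℕ k) +ℕ_) (rhsExponent-closed (suc k) i) ⟨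
  suc (2 *ℕ k) +ℕ rhsExponent (suc k) i ∎
  where
  open ≡-Reasoning
  shift-index : ∀ k i → k +ℕ suc i *ℕ suc (suc i +ℕ 2 *ℕ k)
                      ≡ suc (2 *ℕ k) +ℕ (suc k +ℕ i *ℕ suc (i +ℕ 2 *ℕ suc k))
  shift-index = solve-∀

rhsTerm-summable : ∀ k → Summable (rhsTerm k)
rhsTerm-summable k i = ∣-·ₛ (sign i) (mod-weaken i≤exponent (q^∣mono (rhsExponent k i)))
  where
  i≤exponent : i ≤ rhsExponent k i
  i≤exponent = subst (i ≤_) (sym (rhsExponent-closed k i))
                     (ℕₚ.≤-trans (ℕₚ.m≤m*n i (suc (i +ℕ 2 *ℕ k))) (ℕₚ.m≤n+m _ k))

rhsTerm-zero : ∀ k → rhsTerm k 0 ≗ mono k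
rhsTerm-zero k n =
  trans (ℤₚ.*-identityˡ _) (cong (λ e → mono e n) (trans (rhsExponent-closed k 0) (ℕₚ.+-identityʳ k)))

rhsTerm-suc : ∀ k i → rhsTerm k (suc i) ≗ negS (mono (suc (2 *ℕ k))) ⊛ rhsTerm (suc k) i
rhsTerm-suc k i = begin
  (- s) ·ₛ mono (rhsExponent k (suc i))        ≈⟨ ·ₛ≗constS⊛ (- s) (mono (rhsExponent k (suc i))) ⟩
  constS (- s) ⊛ mono (rhsExponent k (suc i))  ≈⟨ ⊛-cong (constS-neg s) monos ⟩
  negS (constS s) ⊛ (M ⊛ mono e)               ≈⟨ swap-sign (constS s) M (mono e) ⟩
  negS M ⊛ (constS s ⊛ mono e)                 ≈⟨ ⊛-congˡ {negS M} (·ₛ≗constS⊛ s (mono e)) ⟨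
  negS M ⊛ (s ·ₛ mono e)                       ∎
  where
  open SetoidReasoning PS-setoid
  open PS-Solver
  s = sign i
  M = mono (suc (2 *ℕ k))
  e = rhsExponent (suc k) i
  monos : mono (rhsExponent k (suc i)) ≗ M ⊛ mono e
  monos n = trans (cong (λ a → mono a n) (rhsExponent-suc k i)) (mono-+ (suc (2 *ℕ k)) e n)
  swap-sign : ∀ c m f → negS c ⊛ (m ⊛ f) ≗ negS m ⊛ (c ⊛ f)
  swap-sign = solve 3 (λ c m f → (:- c) :* (m :* f) := (:- m) :* (c :* f)) (λ _ → refl)

rhs-recurrence : ∀ k → rhs k ⊕ (mono (suc (2 *ℕ k)) ⊛ rhs (suc k)) ≗ mono k
rhs-recurrence k = begin
  rhs k ⊕ (M ⊛ R)
    ≈⟨ ⊕-congʳ (sumFam-unfold (rhsTerm-summable k)) ⟩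
  (rhsTerm k 0 ⊕ sumFam (rhsTerm k ∘ suc)) ⊕ (M ⊛ R)
    ≈⟨ ⊕-congʳ (⊕-cong (rhsTerm-zero k) (sumFam-cong (rhsTerm-suc k))) ⟩
  (mono k ⊕ sumFam (λ i → negS M ⊛ rhsTerm (suc k) i)) ⊕ (M ⊛ R)
    ≈⟨ ⊕-congʳ (⊕-congˡ {mono k} (sumFam-⊛ (negS M) (rhsTerm-summable (suc k)))) ⟨
  (mono k ⊕ (negS M ⊛ R)) ⊕ (M ⊛ R)
    ≈⟨ cancel (mono k) M R ⟩
  mono k ∎
  where
  open SetoidReasoning PS-setoid
  open PS-Solver
  M = mono (suc (2 *ℕ k))
  R = rhs (suc k)
  cancel : ∀ a m r → (a ⊕ (negS m ⊛ r)) ⊕ (m ⊛ r) ≗ a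
  cancel = solve 3 (λ a m r → (a :+ (:- m) :* r) :+ m :* r := a) (λ _ → refl)

recurrence-unique : ∀ (e : ℕ → ℕ) (X Y : ℕ → PS) →
  (∀ k → X k ⊕ (mono (suc (e k)) ⊛ X (suc k)) ≗ Y k ⊕ (mono (suc (e k)) ⊛ Y (suc k))) →
  ∀ k → X k ≗ Y k
recurrence-unique e X Y same k n = agree (suc n) k n ℕₚ.≤-refl
  where
  agree : ∀ N k → X k ≈ Y k mod-q^ N
  agree zero    k n ()
  agree (suc N) k n n<1+N with ℕₚ.m<1+n⇒m<n∨m≡n n<1+N
  ... | inj₁ n<N  = agree N k n n<N
  ... | inj₂ refl = ∙-cancelʳ _ (X k n) (Y k n) (trans (same k n) (cong (Y k n +_) (sym shifted)))
    where
    shifted : (mono (suc (e k)) ⊛ X (suc k)) n ≡ (mono (suc (e k)) ⊛ Y (suc k)) n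
    shifted = ⊛-mod (mono (suc (e k))) (q^∣mono (suc (e k))) (agree n (suc k))
                    n (s≤s (ℕₚ.m≤n+m n (e k)))

lemma2 : (k n : ℕ) → lhs k n ≡ rhs k n
lemma2 k n = recurrence-unique (2 *ℕ_) lhs rhs same-recurrence k n
  where
  same-recurrence : ∀ k → lhs k ⊕ (mono (suc (2 *ℕ k)) ⊛ lhs (suc k))
                        ≗ rhs k ⊕ (mono (suc (2 *ℕ k)) ⊛ rhs (suc k))
  same-recurrence k m = trans (lhs-recurrence k m) (sym (rhs-recurrence k m))
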